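{- Let $t\ge 3$ be an odd integer, let $d$ be a positive integer with $d\ge \frac{t+1}{2}$, and let $S=(d,d,d,\ldots)$. Then $$\chi_S(G_t)\ge 1+t\left(d-\frac{t-3}{2}\right).$$
   Context: For an odd integer $t\ge 3$, $G_t$ denotes the integer distance graph $G(\mathbb{Z},\{2,t\})$: its vertex set is $\mathbb{Z}$, and distinct $i,j\in\mathbb{Z}$ are adjacent if and only if $|i-j|\in\{2,t\}$. For a graph $G$ and a non-decreasing sequence $S=(a_1,a_2,\ldots)$ of positive integers, an $S$-packing $k$-coloring of $G$ is a map $f:V(G)\to\{1,\ldots,k\}$ such that any two distinct vertices $u,v$ with $f(u)=f(v)=i$ satisfy $d_G(u,v)>a_i$, where $d_G$ is the shortest-path distance. The $S$-packing chromatic number $\chi_S(G)$ is the smallest $k$ for which $G$ has an $S$-packing $k$-coloring. (For $S=(d,d,\ldots)$ this is the $d$-distance chromatic number.) -}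

module Defs where

open import Data.Nat using (ℕ; zero; suc; _≤_)
open import Data.Integer using (ℤ; _-_; ∣_∣)
import Data.Integer as ℤ
open import Data.Fin using (Fin)
open import Data.Product using (∃; _×_)
open import Data.Sum using (_⊎_)
open import Relation.Binary.PropositionalEquality using (_≡_; _≢_)
open import Relation.Nullary using (¬_)

-- The integer distance graph G(ℤ, {2, t}): i ~ j iff |i - j| ∈ {2, t}.
Adj : ℕ → ℤ → ℤ → Set
Adj t i j = ∣ i - j ∣ ≡ 2 ⊎ ∣ i - j ∣ ≡ t

data Walk (t : ℕ) : ℕ → ℤ → ℤ → Set where
  here : ∀ {u} → Walk t zero u u
  step : ∀ {n u v w} → Adj t u v → Walk t n v w → Walk t (suc n) u w

DistLe : ℕ → ℕ → ℤ → ℤ → Set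
DistLe t n u v = ∃ λ m → m ≤ n × Walk t m u v

-- An S-packing k-coloring of G(ℤ,{2,t}) for the constant sequence S = (d,d,d,…):
-- colours are Fin k (i.e. {1,…,k}); two distinct vertices with the same colour
-- must satisfy d_G(u,v) > d, i.e. not d_G(u,v) ≤ d.
IsConstPackingColoring : ℕ → ℕ → (k : ℕ) → (ℤ → Fin k) → Set
IsConstPackingColoring t d k f =
  ∀ u v → u ≢ v → f u ≡ f v → ¬ DistLe t d u v

{-# OPTIONS --safe #-}
module Submission where

-- Write t = 3 + 2s and D = d − s ≥ 2.  Every 0 ≤ x ≤ tD can be written as p·t ± 2j with
-- p + j ≤ d (even residues mod t go forwards, odd ones mostly overshoot to a multiple of
-- t and come back in steps of 2), so the vertices 0, 1, …, tD lie pairwise within distance d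
-- and must all receive different colours.

open import Defs
open import Data.Nat using (ℕ; zero; suc; _+_; _*_; _∸_; _≤_; _<_; _/_; _%_; z≤n; s≤s; s≤s⁻¹)
open import Data.Nat.Properties hiding (_≟_)
open import Data.Nat.DivMod using (m≡m%n+[m/n]*n; m%n<n; m*n/n≡m; m*n%n≡0)
open import Data.Nat.Tactic.RingSolver using (solve-∀)
open import Data.Fin using (Fin; toℕ; _≟_)
open import Data.Fin.Properties using (injective⇒≤; toℕ<n; toℕ-injective)
open import Data.Integer using (ℤ; +_; _-_; _⊖_; ∣_∣)
import Data.Integer.Properties as ℤ
open import Data.Product using (∃; _×_; _,_)
open import Data.Sum using (_⊎_; inj₁; inj₂)
import Data.Sum as Sum
open import Function.Definitions using (Injective)
open import Relation.Nullary using (yes; no; contradiction)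
open import Relation.Binary.PropositionalEquality

adj-sym : ∀ {t u v} → Adj t u v → Adj t v u
adj-sym {u = u} {v} = Sum.map (trans (ℤ.∣i-j∣≡∣j-i∣ v u)) (trans (ℤ.∣i-j∣≡∣j-i∣ v u))

∣[a+c]-a∣≡c : ∀ a c → ∣ + (a + c) - + a ∣ ≡ c
∣[a+c]-a∣≡c a c = begin
  ∣ + (a + c) - + a ∣   ≡⟨ cong ∣_∣ (ℤ.m-n≡m⊖n (a + c) a) ⟩
  ∣ (a + c) ⊖ a ∣       ≡⟨ cong ∣_∣ (ℤ.⊖-≥ (m≤m+n a c)) ⟩
  a + c ∸ a             ≡⟨ m+n∸m≡n a c ⟩
  c                     ∎
  where open ≡-Reasoning

adj-+ : ∀ {t c} a → c ≡ 2 ⊎ c ≡ t → Adj t (+ a) (+ (a + c))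
adj-+ {c = c} a = Sum.map (trans d) (trans d)
  where
  d : ∣ + a - + (a + c) ∣ ≡ c
  d = trans (ℤ.∣i-j∣≡∣j-i∣ (+ a) (+ (a + c))) (∣[a+c]-a∣≡c a c)

walk-++ : ∀ {t m n u v w} → Walk t m u v → Walk t n v w → Walk t (m + n) u w
walk-++ here       q = q
walk-++ (step a p) q = step a (walk-++ p q)

walk-snoc : ∀ {t n u v w} → Walk t n u v → Adj t v w → Walk t (suc n) u w
walk-snoc here       a = step a here
walk-snoc (step b p) a = step b (walk-snoc p a)

walk-reverse : ∀ {t n u v} → Walk t n u v → Walk t n v u
walk-reverse here       = here
walk-reverse (step {u = u} {v} a p) = walk-snoc (walk-reverse p) (adj-sym {u = u} {v} a)

-- The graph is translation invariant, so a displacement x is realised from every start a.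
Displaces : ℕ → ℕ → ℕ → Set
Displaces t n x = ∀ a → Walk t n (+ a) (+ (a + x))

displaces-steps : ∀ {t c} → c ≡ 2 ⊎ c ≡ t → ∀ n → Displaces t n (n * c)
displaces-steps {t} {c} c∈ zero    a = subst (λ b → Walk t 0 (+ a) (+ b)) (sym (+-identityʳ a)) here
displaces-steps {t} {c} c∈ (suc n) a = step (adj-+ a c∈)
  (subst (λ b → Walk t n (+ (a + c)) (+ b)) (+-assoc a c (n * c)) (displaces-steps c∈ n (a + c)))

displaces-++ : ∀ {t m n x y} → Displaces t m x → Displaces t n y → Displaces t (m + n) (x + y)
displaces-++ {t} {m} {n} {x} {y} p q a =
  subst (λ b → Walk t (m + n) (+ a) (+ b)) (+-assoc a x y) (walk-++ (p a) (q (a + x)))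

displaces-back : ∀ {t m n x y} → Displaces t m (x + y) → Displaces t n y → Displaces t (m + n) x
displaces-back {t} {m} {n} {x} {y} p q a = walk-++ (p a)
  (subst (λ b → Walk t n (+ b) (+ (a + x))) (+-assoc a x y) (walk-reverse (q (a + x))))

displaces-forward : ∀ {t} p j → Displaces t (p + j) (p * t + j * 2)
displaces-forward p j = displaces-++ (displaces-steps (inj₂ refl) p) (displaces-steps (inj₁ refl) j)

displaces-backward : ∀ {t x} p e → x + e * 2 ≡ p * t → Displaces t (p + e) x
displaces-backward {t} p e eq =
  displaces-back (subst (Displaces t p) (sym eq) (displaces-steps (inj₂ refl) p)) (displaces-steps (inj₁ refl) e)

Reachable : ℕ → ℕ → ℕ → Set
Reachable t d x = ∃ λ m → m ≤ d × Displaces t m x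

reachable⇒distLe : ∀ {t d x} → Reachable t d x → ∀ a → DistLe t d (+ a) (+ (a + x))
reachable⇒distLe (m , m≤d , p) a = m , m≤d , p a

even-or-odd : ∀ r → ∃ λ j → r ≡ j * 2 ⊎ r ≡ 1 + j * 2
even-or-odd zero          = 0 , inj₁ refl
even-or-odd (suc zero)    = 0 , inj₂ refl
even-or-odd (suc (suc r)) with even-or-odd r
... | j , inj₁ refl = suc j , inj₁ refl
... | j , inj₂ refl = suc j , inj₂ refl

T : ℕ → ℕ
T s = 3 + s * 2

odd≥3⇒T : ∀ t → 3 ≤ t → t % 2 ≡ 1 → ∃ λ s → t ≡ T s
odd≥3⇒T t 3≤t t-odd with even-or-odd t
... | j           , inj₁ refl = contradiction (trans (sym (m*n%n≡0 j 2)) t-odd) λ ()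
... | suc s       , inj₂ refl = s , refl
... | zero        , inj₂ refl with s≤s () ← 3≤t

reachable-even : ∀ s D q j → q ≤ D → (0 < j → q < D) → j ≤ suc s →
  Reachable (T s) (D + s) (j * 2 + q * T s)
reachable-even s D q j q≤D q<D j≤ = q + j , bound j q<D j≤ ,
  subst (Displaces (T s) (q + j)) (+-comm (q * T s) (j * 2)) (displaces-forward q j)
  where
  bound : ∀ j → (0 < j → q < D) → j ≤ suc s → q + j ≤ D + s
  bound zero    _   _         = ≤-trans (≤-reflexive (+-identityʳ q)) (≤-trans q≤D (m≤m+n D s))
  bound (suc j) q<D (s≤s j≤s) = ≤-trans (≤-reflexive (+-suc q j)) (+-mono-≤ (q<D (s≤s z≤n)) j≤s)

reachable-odd-backward : ∀ j e D q → suc q + suc e ≤ D + (j + e) →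
  Reachable (T (j + e)) (D + (j + e)) (1 + j * 2 + q * T (j + e))
reachable-odd-backward j e D q bound = suc q + suc e , bound , displaces-backward (suc q) (suc e) (eq j e q)
  where
  eq : ∀ j e q → 1 + j * 2 + q * (3 + (j + e) * 2) + (1 + e) * 2 ≡ (1 + q) * (3 + (j + e) * 2)
  eq = solve-∀

reachable-odd : ∀ j e D q → 2 ≤ D → q < D → Reachable (T (j + e)) (D + (j + e)) (1 + j * 2 + q * T (j + e))
reachable-odd zero e D zero 2≤D _ = reachable-odd-backward zero e D zero (+-monoˡ-≤ e 2≤D)
reachable-odd zero e D (suc q) _ q<D =
  q + (2 + e) , bound , subst (Displaces (T e) (q + (2 + e))) (eq q e) (displaces-forward q (2 + e))
  where
  -- 1 + (q + 1)·t = q·t + (t + 1) and t + 1 = 2(e + 2)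
  eq : ∀ q e → q * (3 + e * 2) + (2 + e) * 2 ≡ 1 + 0 * 2 + (1 + q) * (3 + e * 2)
  eq = solve-∀
  bound : q + (2 + e) ≤ D + e
  bound = ≤-trans (≤-reflexive (trans (sym (+-assoc q 2 e)) (cong (_+ e) (+-comm q 2)))) (+-monoˡ-≤ e q<D)
reachable-odd (suc j) e D q _ q<D = reachable-odd-backward (suc j) e D q (+-mono-≤ q<D (s≤s (m≤n+m e j)))

reachable-≤ : ∀ s D x → 2 ≤ D → x ≤ T s * D → Reachable (T s) (D + s) x
reachable-≤ s D x 2≤D x≤ = subst (Reachable (T s) (D + s)) (sym x≡) (by-parity (even-or-odd r))
  where
  q r : ℕ
  q = x / T s
  r = x % T s
  x≡ : x ≡ r + q * T s
  x≡ = m≡m%n+[m/n]*n x (T s)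
  r+qT≤DT : r + q * T s ≤ D * T s
  r+qT≤DT = subst₂ _≤_ x≡ (*-comm (T s) D) x≤
  q≤D : q ≤ D
  q≤D = *-cancelʳ-≤ q D (T s) (≤-trans (m≤n+m (q * T s) r) r+qT≤DT)
  q<D : 0 < r → q < D
  q<D 0<r = *-cancelʳ-< (T s) q D (<-≤-trans (m<n+m (q * T s) 0<r) r+qT≤DT)
  r<T : r < T s
  r<T = m%n<n x (T s)
  by-parity : (∃ λ j → r ≡ j * 2 ⊎ r ≡ 1 + j * 2) → Reachable (T s) (D + s) (r + q * T s)
  by-parity (j , inj₁ r≡) rewrite r≡ = reachable-even s D q j q≤D
    (λ 0<j → q<D (subst (0 <_) (sym r≡) (*-monoˡ-< 2 0<j)))
    (*-cancelʳ-≤ j (suc s) 2 (s≤s⁻¹ (subst (_< T s) r≡ r<T)))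
  by-parity (j , inj₂ r≡) with m≤n⇒∃[o]m+o≡n (s≤s⁻¹ (*-cancelʳ-< 2 j (suc s) (s≤s⁻¹ (subst (_< T s) r≡ r<T))))
  ... | e , refl rewrite r≡ = reachable-odd j e D q 2≤D (q<D (subst (0 <_) (sym r≡) (s≤s z≤n)))

distLe-ascending : ∀ {t d N} → (∀ x → x ≤ N → Reachable t d x) → ∀ {i j} → i ≤ j → j ≤ N → DistLe t d (+ i) (+ j)
distLe-ascending {t} {d} reach {i} {j} i≤j j≤N = subst (λ b → DistLe t d (+ i) (+ b)) (m+[n∸m]≡n i≤j)
  (reachable⇒distLe (reach (j ∸ i) (≤-trans (m∸n≤m j i) j≤N)) i)

distLe-sym : ∀ {t d u v} → DistLe t d u v → DistLe t d v u
distLe-sym (m , m≤d , w) = m , m≤d , walk-reverse w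

pairwise-distLe : ∀ {t d N} → (∀ x → x ≤ N → Reachable t d x) → ∀ i j → i ≤ N → j ≤ N → DistLe t d (+ i) (+ j)
pairwise-distLe reach i j i≤N j≤N with ≤-total i j
... | inj₁ i≤j = distLe-ascending reach i≤j j≤N
... | inj₂ j≤i = distLe-sym (distLe-ascending reach j≤i i≤N)

clique≤colours : ∀ {t d k n} {f : ℤ → Fin k} → IsConstPackingColoring t d k f →
  (g : Fin n → ℤ) → Injective _≡_ _≡_ g → (∀ i j → DistLe t d (g i) (g j)) → n ≤ k
clique≤colours {f = f} coloring g g-inj close = injective⇒≤ {f = λ i → f (g i)} inj
  where
  inj : ∀ {i j} → f (g i) ≡ f (g j) → i ≡ j
  inj {i} {j} fgi≡fgj with i ≟ j
  ... | yes i≡j = i≡j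
  ... | no  i≢j = contradiction (close i j) (coloring (g i) (g j) (λ gi≡gj → i≢j (g-inj gi≡gj)) fgi≡fgj)

colours-lower-bound : ∀ s d k (f : ℤ → Fin k) → 2 + s ≤ d → IsConstPackingColoring (T s) d k f →
  suc (T s * (d ∸ s)) ≤ k
colours-lower-bound s d k f 2+s≤d coloring = clique≤colours coloring (λ i → + toℕ i)
  (λ eq → toℕ-injective (cong ∣_∣ eq))
  (λ i j → subst (λ b → DistLe (T s) b (+ toℕ i) (+ toℕ j)) (m∸n+n≡m (≤-trans (m≤n+m s 2) 2+s≤d))
    (pairwise-distLe (λ x x≤ → reachable-≤ s (d ∸ s) x 2≤D x≤)
      (toℕ i) (toℕ j) (s≤s⁻¹ (toℕ<n i)) (s≤s⁻¹ (toℕ<n j))))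
  where
  2≤D : 2 ≤ d ∸ s
  2≤D = subst (_≤ d ∸ s) (m+n∸n≡m 2 s) (∸-monoˡ-≤ s 2+s≤d)

theorem5 : (t d : ℕ) → 3 ≤ t → t % 2 ≡ 1 → 1 ≤ d → (t + 1) / 2 ≤ d →
    (k : ℕ) (f : ℤ → Fin k) → IsConstPackingColoring t d k f →
    1 + t * (d ∸ ((t ∸ 3) / 2)) ≤ k
theorem5 t d 3≤t t-odd _ t+1/2≤d k f coloring with odd≥3⇒T t 3≤t t-odd
... | s , refl = subst (λ z → 1 + T s * (d ∸ z) ≤ k) (sym (m*n/n≡m s 2))
  (colours-lower-bound s d k f (subst (_≤ d) [t+1]/2≡2+s t+1/2≤d) coloring)
  where
  [t+1]/2≡2+s : (T s + 1) / 2 ≡ 2 + s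
  [t+1]/2≡2+s = trans (cong (_/ 2) (+-comm (T s) 1)) (m*n/n≡m (2 + s) 2)
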